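{- Let $G=(V,E)$ be a twinless strongly connected directed graph. Consider the following algorithm. Choose $r\in V$; construct a spanning tree $T$ of $G$ rooted at $r$ directed away from $r$ and a spanning tree $T_{r}$ rooted at $r$ in $G^{r}=(V,E^{r})$ directed away from $r$; set $E_{t}\leftarrow E(T)\cup\{(j,i):(i,j)\in E(T_{r})\}$. While $(V,E_{t})$ is not twinless strongly connected: compute the twinless strongly connected components of $(V,E_{t})$; pick an edge $(a,b)\in E\setminus E_{t}$ whose endpoints lie in distinct twinless strongly connected components of $(V,E_{t})$; find a simple directed path $p$ from $b$ to $a$ in $(V,E_{t})$; let $S$ be the set of edges $(j,i)$ such that $(i,j)$ is an edge of $p$ whose endpoints lie in distinct twinless strongly connected components of $(V,E_{t})$; set $E_{t}\leftarrow (E_{t}\cup\{(a,b)\})\setminus S$. Output $(V,E_{t})$. This algorithm has approximation factor $2$ for the MTSCSS problem, i.e. its output $(V,E_{t})$ is a twinless strongly connected spanning subgraph of $G$ with $|E_{t}|\le 2|E^{*}|$ for an optimal solution $E^{*}$ of the MTSCSS problem on $G$.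
   Context: Directed graphs are finite with no loops and no parallel edges; $E^{r}=\{(v,w)\mid (w,v)\in E\}$. A directed graph is twinless strongly connected if for every pair of vertices $a,b$ there is a directed path $p$ from $a$ to $b$ and a directed path $q$ from $b$ to $a$ such that for every edge $(c,d)$ of $p$, the edge $(d,c)$ is not an edge of $q$. In a directed graph $H$, two vertices are twinless strongly connected if such paths exist in $H$; the equivalence classes are the twinless strongly connected components of $H$. The MTSCSS problem: given a twinless strongly connected $G=(V,E)$, find a minimum-cardinality $E_{1}\subseteq E$ with $(V,E_{1})$ twinless strongly connected. -}

module Defs where

open import Data.Nat using (ℕ; zero; suc; _+_; _*_; _≤_)
open import Data.Fin using (Fin)
open import Data.Bool using (Bool; true; false; if_then_else_; _∨_)
open import Data.List using (List; []; _∷_; map; allFin)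
open import Data.Nat.ListAction using (sum)
open import Data.List.Membership.Propositional using (_∈_)
open import Data.List.Relation.Unary.Unique.Propositional using (Unique)
open import Data.Product using (Σ; ∃; ∃-syntax; _×_; _,_)
open import Data.Sum using (_⊎_)
open import Relation.Nullary using (¬_)
open import Relation.Binary.PropositionalEquality using (_≡_; _≢_)

-- A directed graph on vertex set Fin n, given by its edge relation
-- (adjacency matrix).  A Bool matrix automatically has no parallel edges.
Graph : ℕ → Set
Graph n = Fin n → Fin n → Bool

Loopless : ∀ {n} → Graph n → Set
Loopless {n} G = (v : Fin n) → G v v ≡ false

rev : ∀ {n} → Graph n → Graph n
rev G i j = G j i

_∪_ : ∀ {n} → Graph n → Graph n → Graph n
(A ∪ B) i j = A i j ∨ B i j

_⊆_ : ∀ {n} → Graph n → Graph n → Set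
_⊆_ {n} A B = (i j : Fin n) → A i j ≡ true → B i j ≡ true

size : ∀ {n} → Graph n → ℕ
size {n} A = sum (map (λ i → sum (map (λ j → if A i j then 1 else 0) (allFin n))) (allFin n))

data Walk {n} (A : Graph n) : Fin n → Fin n → Set where
  [] : ∀ {a} → Walk A a a
  _∷_ : ∀ {a b c} → A a b ≡ true → Walk A b c → Walk A a c

vertices : ∀ {n} {A : Graph n} {a b} → Walk A a b → List (Fin n)
vertices {a = a} [] = a ∷ []
vertices {a = a} (_ ∷ w) = a ∷ vertices w

edges : ∀ {n} {A : Graph n} {a b} → Walk A a b → List (Fin n × Fin n)
edges [] = []
edges {a = a} (_∷_ {b = b} _ w) = (a , b) ∷ edges w

Simple : ∀ {n} {A : Graph n} {a b} → Walk A a b → Set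
Simple w = Unique (vertices w)

TwinlessConn : ∀ {n} → Graph n → Fin n → Fin n → Set
TwinlessConn A a b =
  Σ (Walk A a b) λ p → Σ (Walk A b a) λ q →
    Simple p × Simple q ×
    (∀ c d → (c , d) ∈ edges p → ¬ ((d , c) ∈ edges q))

TSC : ∀ {n} → Graph n → Set
TSC {n} A = (a b : Fin n) → TwinlessConn A a b

SpanningOutTree : ∀ {n} → Graph n → Fin n → Graph n → Set
SpanningOutTree {n} G r T =
  (T ⊆ G) ×
  ((u : Fin n) → T u r ≡ false) ×
  ((v : Fin n) → v ≢ r → ∃[ u ] (T u v ≡ true × ((u' : Fin n) → T u' v ≡ true → u' ≡ u))) ×
  ((v : Fin n) → Walk T r v)

Optimal : ∀ {n} → Graph n → Graph n → Set
Optimal {n} G E* =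
  (E* ⊆ G) × TSC E* × ((E₁ : Graph n) → E₁ ⊆ G → TSC E₁ → size E* ≤ size E₁)

-- One iteration of the while loop (all admissible choices of (a,b) and p):
-- Et' = (Et ∪ {(a,b)}) \ S, S = {(j,i) | (i,j) ∈ p, i,j in distinct TSCCs of Et}.
Step : ∀ {n} → Graph n → Graph n → Graph n → Set
Step {n} G Et Et' =
  Σ (Fin n) λ a → Σ (Fin n) λ b →
    G a b ≡ true × Et a b ≡ false × ¬ TwinlessConn Et a b ×
    Σ (Walk Et b a) λ p → Simple p ×
      ((x y : Fin n) →
        (Et' x y ≡ true →
           (Et x y ≡ true ⊎ (x ≡ a × y ≡ b)) ×
           ¬ ((y , x) ∈ edges p × ¬ TwinlessConn Et y x)) ×
        ((Et x y ≡ true ⊎ (x ≡ a × y ≡ b)) →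
           ¬ ((y , x) ∈ edges p × ¬ TwinlessConn Et y x) →
           Et' x y ≡ true))

data Run {n} (G : Graph n) : Graph n → Graph n → Set where
  done : ∀ {Et} → TSC Et → Run G Et Et
  step : ∀ {Et Et' Eout} → ¬ TSC Et → Step G Et Et' → Run G Et' Eout → Run G Et Eout

-- The while loop, started at Et, never gets stuck and always halts,
-- whatever admissible choices are made.
data Terminates {n} (G : Graph n) (Et : Graph n) : Set where
  halt : TSC Et → Terminates G Et
  continue : ¬ TSC Et → (∃[ Et' ] Step G Et Et') →
             ((Et' : Graph n) → Step G Et Et' → Terminates G Et') → Terminates G Et

-- Twinless connectivity is an equivalence relation: u and v are twinless connected exactly when some
-- closed walk through both never uses an arc together with its twin, and two such walks can be spliced.
-- Throughout the loop E_t is a strongly connected subgraph of G with |E_t| ≤ 2(n − 1), as it is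
-- initially, |T| + |T_r| = 2(n − 1).  An iteration adds (a,b) but removes at least one arc: p joins b to
-- a, which lie in distinct components, so some arc (i,j) of p joins distinct components, and in a
-- strongly connected graph such an arc has its twin (j,i).  Every removed arc is bypassed through p and
-- (a,b), and no twinless connected pair is separated while a and b become connected, so the number of
-- twinless connected pairs grows and the loop halts.  It never gets stuck: if no arc of G outside E_t
-- joined distinct components, then every arc of G, hence every pair of vertices, would be twinless
-- connected in E_t.  Finally every twinless strongly connected spanning subgraph has at least n − 1 arcs.

module Submission where

open import Defs
open import Data.Nat using (ℕ; zero; suc; _+_; _*_; _≤_; _<_; z≤n; s≤s)
open import Data.Nat.Tactic.RingSolver using (solve-∀)
open import Data.Nat.Properties
  using (module ≤-Reasoning; ≤-refl; ≤-reflexive; ≤-trans; ≤-<-trans; <⇒≤; <⇒≱; m≤n+m; m≤m+n; +-suc; +-identityʳ;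
         *-identityʳ; *-zeroʳ; *-distribˡ-+; +-mono-≤; +-monoˡ-≤; +-mono-<-≤; +-mono-≤-<; +-cancelʳ-≤; *-monoʳ-≤;
         +-*-semiring)
open import Algebra.Properties.Semiring.Sum +-*-semiring
  using (sum; sum-syntax; ∑-distrib-+; ∑-comm; *-distribˡ-sum; sum-cong-≗)
import Data.Nat.ListAction as List
open import Data.Fin as Fin using (Fin)
open import Data.Fin.Properties using (_≟_; any?; all?; injective⇒≤)
open import Data.Bool using (Bool; true; false; if_then_else_; _∨_)
import Data.Bool.Properties as Bool
open import Data.List using (List; []; _∷_; _++_; length; lookup; map; allFin; tabulate)
open import Data.List.Properties using (map-tabulate)
open import Data.List.Membership.Propositional using (_∈_; _∉_)
open import Data.List.Membership.Propositional.Properties using (∈-++⁻; ∈-++⁺ˡ; ∈-++⁺ʳ; ∈-lookup)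
import Data.List.Membership.DecPropositional as DecMembership
open import Data.List.Relation.Binary.Subset.Propositional using () renaming (_⊆_ to _⊆ₗ_)
open import Data.List.Relation.Binary.Subset.Propositional.Properties
  using (⊆-trans; ⊆-reflexive; ⊆-reflexive-↭) renaming (++⁺ to ⊆-++⁺)
open import Data.List.Relation.Binary.Permutation.Propositional using (_↭_; ↭-reflexive; ↭-sym; ↭-trans)
open import Data.List.Relation.Binary.Permutation.Propositional.Properties using (++-comm)
open import Data.List.Relation.Unary.Any using (here; there)
open import Data.List.Relation.Unary.All as All using (All; []; _∷_)
open import Data.List.Relation.Unary.All.Properties using (¬Any⇒All¬) renaming (++⁺ to All-++⁺)
open import Data.List.Relation.Unary.AllPairs using ([]; _∷_)
open import Data.List.Relation.Unary.Unique.Propositional using (Unique)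
open import Data.List.Relation.Unary.Unique.Propositional.Properties using (Unique[x∷xs]⇒x∉xs)
open import Data.List.Relation.Unary.Unique.DecPropositional using (unique?)
open import Data.Product using (Σ; ∃-syntax; _×_; _,_; proj₁; proj₂)
import Data.Product.Properties as Product
open import Data.Sum using (_⊎_; inj₁; inj₂)
open import Data.Empty using (⊥-elim)
open import Data.Unit using (⊤)
open import Relation.Nullary using (¬_; Dec; yes; no; does; ¬?; _×-dec_; _⊎-dec_)
open import Relation.Nullary.Decidable using (map′; dec-true; dec-false)
open import Function.Definitions using (Injective)
open import Axiom.UniquenessOfIdentityProofs using (module Decidable⇒UIP)
open import Relation.Binary.PropositionalEquality
open import Function using (_∘_)

private
  variable
    n : ℕ
    H K : Graph n
    a b c d u v x y z : Fin n

Unique-∷ : {A : Set} {x : A} {xs : List A} → x ∉ xs → Unique xs → Unique (x ∷ xs)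
Unique-∷ {xs = xs} x∉xs u = ¬Any⇒All¬ xs x∉xs ∷ u

Unique-tail : {A : Set} {x : A} {xs : List A} → Unique (x ∷ xs) → Unique xs
Unique-tail (_ ∷ u) = u

true≢false : true ≢ false
true≢false ()

dec-true⁻¹ : {P : Set} (P? : Dec P) → does P? ≡ true → P
dec-true⁻¹ (yes p) _ = p

-- Walks

_++ʷ_ : Walk H a b → Walk H b c → Walk H a c
[] ++ʷ q = q
(e ∷ p) ++ʷ q = e ∷ (p ++ʷ q)

edges-++ʷ : (p : Walk H a b) (q : Walk H b c) → edges (p ++ʷ q) ≡ edges p ++ edges q
edges-++ʷ [] q = refl
edges-++ʷ (e ∷ p) q = cong (_ ∷_) (edges-++ʷ p q)

start∈vertices : (p : Walk H a b) → a ∈ vertices p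
start∈vertices [] = here refl
start∈vertices (e ∷ p) = here refl

end∈vertices : (p : Walk H a b) → b ∈ vertices p
end∈vertices [] = here refl
end∈vertices (e ∷ p) = there (end∈vertices p)

∈-vertices-++ʷˡ : (p : Walk H a b) (q : Walk H b c) → z ∈ vertices p → z ∈ vertices (p ++ʷ q)
∈-vertices-++ʷˡ [] q (here refl) = start∈vertices q
∈-vertices-++ʷˡ (e ∷ p) q (here refl) = here refl
∈-vertices-++ʷˡ (e ∷ p) q (there m) = there (∈-vertices-++ʷˡ p q m)

∈-vertices-++ʷʳ : (p : Walk H a b) (q : Walk H b c) → z ∈ vertices q → z ∈ vertices (p ++ʷ q)
∈-vertices-++ʷʳ [] q m = m
∈-vertices-++ʷʳ (e ∷ p) q m = there (∈-vertices-++ʷʳ p q m)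

edge⇒arc : (p : Walk H a b) → (c , d) ∈ edges p → H c d ≡ true
edge⇒arc (e ∷ p) (here refl) = e
edge⇒arc (e ∷ p) (there m) = edge⇒arc p m

edge⇒vertices : (p : Walk H a b) → (c , d) ∈ edges p → c ∈ vertices p × d ∈ vertices p
edge⇒vertices (e ∷ p) (here refl) = here refl , there (start∈vertices p)
edge⇒vertices (e ∷ p) (there m) with edge⇒vertices p m
... | c∈ , d∈ = there c∈ , there d∈

splitAt : (p : Walk H a b) → z ∈ vertices p →
  Σ (Walk H a z) λ p₁ → Σ (Walk H z b) λ p₂ → edges p₁ ++ edges p₂ ≡ edges p
splitAt [] (here refl) = [] , [] , refl
splitAt (e ∷ p) (here refl) = [] , e ∷ p , refl
splitAt (e ∷ p) (there m) with splitAt p m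
... | p₁ , p₂ , eq = e ∷ p₁ , p₂ , cong (_ ∷_) eq

prefixTo : (p : Walk H a b) → z ∈ vertices p → Σ (Walk H a z) λ p₁ → edges p₁ ⊆ₗ edges p
prefixTo p z∈p with splitAt p z∈p
... | p₁ , p₂ , eq = p₁ , subst (_ ∈_) eq ∘ ∈-++⁺ˡ

suffixFrom : (p : Walk H a b) → z ∈ vertices p → Σ (Walk H z b) λ p₂ → edges p₂ ⊆ₗ edges p
suffixFrom p z∈p with splitAt p z∈p
... | p₁ , p₂ , eq = p₂ , subst (_ ∈_) eq ∘ ∈-++⁺ʳ (edges p₁)

rotate : (W : Walk H u u) → v ∈ vertices W →
  Σ (Walk H v v) λ W′ → edges W′ ⊆ₗ edges W × edges W ⊆ₗ edges W′
rotate W v∈W with splitAt W v∈W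
... | p₁ , p₂ , eq = p₂ ++ʷ p₁ , ⊆-reflexive-↭ π , ⊆-reflexive-↭ (↭-sym π)
  where
  π : edges (p₂ ++ʷ p₁) ↭ edges W
  π = ↭-trans (↭-reflexive (edges-++ʷ p₂ p₁)) (↭-trans (++-comm (edges p₂) (edges p₁)) (↭-reflexive eq))

lastArc : Walk H a b → a ≢ b → ∃[ u ] H u b ≡ true
lastArc [] a≢a = ⊥-elim (a≢a refl)
lastArc (e ∷ p) _ = go e p
  where
  go : H x y ≡ true → Walk H y z → ∃[ u ] H u z ≡ true
  go e [] = _ , e
  go _ (e ∷ p) = go e p

mapWalk : (p : Walk H a b) → All (λ (c , d) → K c d ≡ true) (edges p) → Walk K a b
mapWalk [] [] = []
mapWalk (e ∷ p) (e′ ∷ es) = e′ ∷ mapWalk p es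

edges-mapWalk : (p : Walk H a b) (es : All (λ (c , d) → K c d ≡ true) (edges p)) →
  edges (mapWalk p es) ≡ edges p
edges-mapWalk [] [] = refl
edges-mapWalk (e ∷ p) (e′ ∷ es) = cong (_ ∷_) (edges-mapWalk p es)

vertices-mapWalk : (p : Walk H a b) (es : All (λ (c , d) → K c d ≡ true) (edges p)) →
  vertices (mapWalk p es) ≡ vertices p
vertices-mapWalk [] [] = refl
vertices-mapWalk (e ∷ p) (e′ ∷ es) = cong (_ ∷_) (vertices-mapWalk p es)

∪-⊆ˡ : (A B : Graph n) → A ⊆ (A ∪ B)
∪-⊆ˡ A B x y e rewrite e = refl

∪-⊆ʳ : (A B : Graph n) → B ⊆ (A ∪ B)
∪-⊆ʳ A B x y e rewrite e = Bool.∨-zeroʳ (A x y)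

Walk-⊆ : H ⊆ K → Walk H a b → Walk K a b
Walk-⊆ H⊆K [] = []
Walk-⊆ H⊆K (e ∷ p) = H⊆K _ _ e ∷ Walk-⊆ H⊆K p

reverseWalk : Walk H a b → Walk (rev H) b a
reverseWalk [] = []
reverseWalk (e ∷ p) = reverseWalk p ++ʷ (e ∷ [])

replaceArcs : {Q : Fin n × Fin n → Set} (w : Walk H x y) →
  (∀ {u v} → (u , v) ∈ edges w → Σ (Walk K u v) λ s → All Q (edges s)) →
  Σ (Walk K x y) λ w′ → All Q (edges w′)
replaceArcs [] _ = [] , []
replaceArcs {Q = Q} (e ∷ w) replace with replace (here refl) | replaceArcs w (replace ∘ there)
... | s , Qs | w′ , Qw′ = s ++ʷ w′ , subst (All Q) (sym (edges-++ʷ s w′)) (All-++⁺ Qs Qw′)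

dropUntil : (p : Walk H c b) → a ∈ vertices p → Simple p →
  Σ (Walk H a b) λ q → Simple q × edges q ⊆ₗ edges p
dropUntil [] (here refl) s = [] , s , λ m → m
dropUntil (e ∷ p) (here refl) s = e ∷ p , s , λ m → m
dropUntil (e ∷ p) (there m) s with dropUntil p m (Unique-tail s)
... | q , sq , sub = q , sq , λ x → there (sub x)

loopErase : (p : Walk H a b) → Σ (Walk H a b) λ q → Simple q × edges q ⊆ₗ edges p
loopErase [] = [] , [] ∷ [] , λ m → m
loopErase {H = H} {a = a} {b = b} (_∷_ {b = a′} e p) = prepend (loopErase p)
  where
  prepend : Σ (Walk H a′ b) (λ q → Simple q × edges q ⊆ₗ edges p) →
            Σ (Walk H a b) (λ q → Simple q × edges q ⊆ₗ edges (e ∷ p))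
  prepend (q , sq , sub) with DecMembership._∈?_ _≟_ a (vertices q)
  ... | yes a∈q with dropUntil q a∈q sq
  ...   | r , sr , sub′ = r , sr , there ∘ sub ∘ sub′
  prepend (q , sq , sub) | no a∉q =
    e ∷ q , Unique-∷ a∉q sq , λ { (here eq) → here eq ; (there m) → there (sub m) }

walkLength : Walk H a b → ℕ
walkLength [] = 0
walkLength (_ ∷ p) = suc (walkLength p)

length-vertices : (p : Walk H a b) → length (vertices p) ≡ suc (walkLength p)
length-vertices [] = refl
length-vertices (e ∷ p) = cong suc (length-vertices p)

lookup-injective : {A : Set} {xs : List A} → Unique xs → Injective _≡_ _≡_ (lookup xs)
lookup-injective {xs = _ ∷ _} u {Fin.zero} {Fin.zero} _ = refl
lookup-injective {xs = _ ∷ xs} u {Fin.zero} {Fin.suc j} eq =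
  ⊥-elim (Unique[x∷xs]⇒x∉xs u (subst (_∈ xs) (sym eq) (∈-lookup j)))
lookup-injective {xs = _ ∷ xs} u {Fin.suc i} {Fin.zero} eq =
  ⊥-elim (Unique[x∷xs]⇒x∉xs u (subst (_∈ xs) eq (∈-lookup i)))
lookup-injective {xs = _ ∷ _} u {Fin.suc i} {Fin.suc j} eq = cong Fin.suc (lookup-injective (Unique-tail u) eq)

Simple⇒walkLength< : {H : Graph n} (p : Walk H a b) → Simple p → walkLength p < n
Simple⇒walkLength< p s = subst (_≤ _) (length-vertices p) (injective⇒≤ (lookup-injective s))

anyWalk? : (k : ℕ) (P : Walk H a b → Set) → (∀ w → Dec (P w)) →
  Dec (Σ (Walk H a b) λ w → walkLength w ≤ k × P w)
anyWalk? {a = a} {b = b} zero P P? with a ≟ b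
... | no a≢b = no λ { ([] , _ , _) → a≢b refl ; (_ ∷ _ , () , _) }
... | yes refl = map′ (λ pw → [] , z≤n , pw) (λ { ([] , _ , pw) → pw ; (_ ∷ _ , () , _) }) (P? [])
anyWalk? {H = H} {a = a} {b = b} (suc k) P P? =
  map′ (λ { (inj₁ (w , l , pw)) → w , ≤-trans l z≤n , pw ; (inj₂ (c , e , w , l , pw)) → e ∷ w , s≤s l , pw })
       (λ { ([] , _ , pw) → inj₁ ([] , z≤n , pw) ; (e ∷ w , s≤s l , pw) → inj₂ (_ , e , w , l , pw) })
       (anyWalk? zero P P? ⊎-dec any? (λ c → viaArc c (H a c) refl))
  where
  viaArc : (c : Fin _) (h : Bool) → H a c ≡ h →
    Dec (Σ (H a c ≡ true) λ e → Σ (Walk H c b) λ w → walkLength w ≤ k × P (e ∷ w))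
  viaArc c false ac≡false = no λ (ac≡true , _) → true≢false (trans (sym ac≡true) ac≡false)
  viaArc c true ac≡true =
    map′ (λ (w , l , pw) → ac≡true , w , l , pw)
         (λ (e , w , l , pw) → w , l , subst (λ e → P (e ∷ w)) (Decidable⇒UIP.≡-irrelevant Bool._≟_ e ac≡true) pw)
         (anyWalk? k (λ w → P (ac≡true ∷ w)) (λ w → P? (ac≡true ∷ w)))

module _ (V : List (Fin n)) where
  private
    _∈V? : (x : Fin n) → Dec (x ∈ V)
    x ∈V? = DecMembership._∈?_ _≟_ x V

    lastVisit′ : (p : Walk H x z) →
      (∃[ y ] y ∈ V × Σ (Walk H y z) λ s → edges s ⊆ₗ edges p × (∀ {e f} → (e , f) ∈ edges s → f ∉ V))
      ⊎ (∀ {u} → u ∈ vertices p → u ∉ V)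
    lastVisit′ {x = x} [] with x ∈V?
    ... | yes x∈V = inj₁ (x , x∈V , [] , (λ ()) , λ ())
    ... | no x∉V = inj₂ λ { (here refl) → x∉V }
    lastVisit′ {x = x} (e ∷ p) with lastVisit′ p
    ... | inj₁ (y , y∈V , s , sub , out) = inj₁ (y , y∈V , s , there ∘ sub , out)
    ... | inj₂ avoids with x ∈V?
    ...   | yes x∈V = inj₁ (x , x∈V , e ∷ p , (λ m → m) ,
              λ { (here refl) → avoids (start∈vertices p) ; (there m) → avoids (proj₂ (edge⇒vertices p m)) })
    ...   | no x∉V = inj₂ λ { (here refl) → x∉V ; (there m) → avoids m }

  lastVisit : (p : Walk H x z) → x ∈ V →
    ∃[ y ] y ∈ V × Σ (Walk H y z) λ s → edges s ⊆ₗ edges p × (∀ {e f} → (e , f) ∈ edges s → f ∉ V)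
  lastVisit p x∈V with lastVisit′ p
  ... | inj₁ r = r
  ... | inj₂ avoids = ⊥-elim (avoids (start∈vertices p) x∈V)

  firstVisit : (q : Walk H x z) → z ∈ V →
    ∃[ y ] y ∈ V × Σ (Walk H x y) λ t → edges t ⊆ₗ edges q × (∀ {e f} → (e , f) ∈ edges t → e ∉ V)
  firstVisit {x = x} [] z∈V = x , z∈V , [] , (λ ()) , λ ()
  firstVisit {x = x} (e ∷ q) z∈V with x ∈V?
  ... | yes x∈V = x , x∈V , [] , (λ ()) , λ ()
  ... | no x∉V with firstVisit q z∈V
  ...   | y , y∈V , t , sub , out = y , y∈V , e ∷ t , (λ { (here eq) → here eq ; (there m) → there (sub m) }) ,
            λ { (here refl) → x∉V ; (there m) → out m }

-- Twinless connectivity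

TwinFree : List (Fin n × Fin n) → Set
TwinFree es = ∀ {c d} → (c , d) ∈ es → (d , c) ∉ es

TwinFree-⊆ : {es fs : List (Fin n × Fin n)} → es ⊆ₗ fs → TwinFree fs → TwinFree es
TwinFree-⊆ sub tf m m′ = tf (sub m) (sub m′)

TwinFree-++ : {es fs : List (Fin n × Fin n)} → TwinFree es → TwinFree fs →
  (∀ {c d} → (c , d) ∈ es → (d , c) ∉ fs) → TwinFree (es ++ fs)
TwinFree-++ {es = es} tfe tff cross m m′ with ∈-++⁻ es m | ∈-++⁻ es m′
... | inj₁ x | inj₁ y = tfe x y
... | inj₁ x | inj₂ y = cross x y
... | inj₂ x | inj₁ y = cross y x
... | inj₂ x | inj₂ y = tff x y

++-regroup-⊆ : {A : Set} (ws xs ys zs : List A) → ws ++ (xs ++ (ys ++ zs)) ⊆ₗ (ws ++ zs) ++ (xs ++ ys)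
++-regroup-⊆ ws xs ys zs m with ∈-++⁻ ws m
... | inj₁ m′ = ∈-++⁺ˡ (∈-++⁺ˡ m′)
... | inj₂ m′ with ∈-++⁻ xs m′
...   | inj₁ m″ = ∈-++⁺ʳ (ws ++ zs) (∈-++⁺ˡ m″)
...   | inj₂ m″ with ∈-++⁻ ys m″
...     | inj₁ m‴ = ∈-++⁺ʳ (ws ++ zs) (∈-++⁺ʳ xs m‴)
...     | inj₂ m‴ = ∈-++⁺ˡ (∈-++⁺ʳ ws m‴)

Simple⇒TwinFree : (p : Walk H a b) → Simple p → TwinFree (edges p)
Simple⇒TwinFree (e ∷ p) s (here refl) (here refl) = Unique[x∷xs]⇒x∉xs s (start∈vertices p)
Simple⇒TwinFree (e ∷ p) s (here refl) (there m) = Unique[x∷xs]⇒x∉xs s (proj₂ (edge⇒vertices p m))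
Simple⇒TwinFree (e ∷ p) s (there m) (here refl) = Unique[x∷xs]⇒x∉xs s (proj₂ (edge⇒vertices p m))
Simple⇒TwinFree (e ∷ p) s (there m) (there m′) = Simple⇒TwinFree p (Unique-tail s) m m′

TwinlessPair⇒TwinFree : (p : Walk H u v) (q : Walk H v u) → Simple p → Simple q →
  (∀ c d → (c , d) ∈ edges p → (d , c) ∉ edges q) → TwinFree (edges p ++ edges q)
TwinlessPair⇒TwinFree p q sp sq p∦q = TwinFree-++ (Simple⇒TwinFree p sp) (Simple⇒TwinFree q sq) (p∦q _ _)

TwinFreeClosedWalk : Graph n → Fin n → Fin n → Set
TwinFreeClosedWalk H u v = Σ (Walk H u u) λ W → v ∈ vertices W × TwinFree (edges W)

TwinlessConn⇒TwinFreeClosedWalk : TwinlessConn H u v → TwinFreeClosedWalk H u v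
TwinlessConn⇒TwinFreeClosedWalk (p , q , sp , sq , p∦q) =
  p ++ʷ q , ∈-vertices-++ʷˡ p q (end∈vertices p) ,
  TwinFree-⊆ (⊆-reflexive (edges-++ʷ p q)) (TwinlessPair⇒TwinFree p q sp sq p∦q)

TwinFreeClosedWalk⇒TwinlessConn : TwinFreeClosedWalk H u v → TwinlessConn H u v
TwinFreeClosedWalk⇒TwinlessConn (W , v∈W , tf) with splitAt W v∈W
... | p₁ , p₂ , eq with loopErase p₁ | loopErase p₂
... | q₁ , s₁ , sub₁ | q₂ , s₂ , sub₂ =
  q₁ , q₂ , s₁ , s₂ , λ c d m₁ m₂ →
    tf (subst (_ ∈_) eq (∈-++⁺ˡ (sub₁ m₁))) (subst (_ ∈_) eq (∈-++⁺ʳ (edges p₁) (sub₂ m₂)))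

TwinFreeClosedWalk-arc⇒TwinlessConn : (W : Walk H u u) → TwinFree (edges W) → (c , d) ∈ edges W →
  TwinlessConn H c d
TwinFreeClosedWalk-arc⇒TwinlessConn W tf cd∈W with rotate W (proj₁ (edge⇒vertices W cd∈W))
... | W′ , W′⊆W , W⊆W′ =
  TwinFreeClosedWalk⇒TwinlessConn (W′ , proj₂ (edge⇒vertices W′ (W⊆W′ cd∈W)) , TwinFree-⊆ W′⊆W tf)

TwinlessConn-refl : TwinlessConn H u u
TwinlessConn-refl = [] , [] , [] ∷ [] , [] ∷ [] , λ _ _ ()

TwinlessConn-sym : TwinlessConn H u v → TwinlessConn H v u
TwinlessConn-sym (p , q , sp , sq , p∦q) = q , p , sq , sp , λ c d m₁ m₂ → p∦q d c m₂ m₁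

-- Splice into a twin-free closed walk W through a and b the part of the twinless pair b ⇄ c that runs
-- outside W: after the last visit of p to W, and before the first visit of q to W.  The twin of an arc
-- of W has both ends on W, while each spliced arc has an end off W.
TwinlessConn-trans : TwinlessConn H a b → TwinlessConn H b c → TwinlessConn H a c
TwinlessConn-trans {H = H} {a = a} {c = c} ab (p , q , sp , sq , p∦q)
  with TwinlessConn⇒TwinFreeClosedWalk ab
... | W , b∈W , tfW
  with lastVisit (vertices W) p b∈W | firstVisit (vertices W) q b∈W
... | y , y∈W , s , s⊆p , s-out | x , x∈W , t , t⊆q , t-out
  with prefixTo W y∈W | suffixFrom W x∈W
... | pre , pre⊆W | suf , suf⊆W =
  TwinFreeClosedWalk⇒TwinlessConn (W′ , c∈W′ , TwinFree-⊆ W′⊆ (TwinFree-++ tf-old tf-new cross))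
  where
  W′ : Walk H a a
  W′ = pre ++ʷ (s ++ʷ (t ++ʷ suf))
  c∈W′ : c ∈ vertices W′
  c∈W′ = ∈-vertices-++ʷʳ pre _ (∈-vertices-++ʷʳ s _ (start∈vertices (t ++ʷ suf)))
  old new : List (Fin _ × Fin _)
  old = edges pre ++ edges suf
  new = edges s ++ edges t
  W′⊆ : edges W′ ⊆ₗ old ++ new
  W′⊆ = ⊆-trans (⊆-reflexive (trans (edges-++ʷ pre _) (cong (edges pre ++_)
          (trans (edges-++ʷ s _) (cong (edges s ++_) (edges-++ʷ t suf))))))
        (++-regroup-⊆ (edges pre) (edges s) (edges t) (edges suf))
  old⊆W : old ⊆ₗ edges W
  old⊆W m with ∈-++⁻ (edges pre) m
  ... | inj₁ m′ = pre⊆W m′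
  ... | inj₂ m′ = suf⊆W m′
  tf-old : TwinFree old
  tf-old = TwinFree-⊆ old⊆W tfW
  tf-new : TwinFree new
  tf-new = TwinFree-⊆ (⊆-++⁺ s⊆p t⊆q) (TwinlessPair⇒TwinFree p q sp sq p∦q)
  cross : ∀ {u v} → (u , v) ∈ old → (v , u) ∉ new
  cross m m′ with edge⇒vertices W (old⊆W m) | ∈-++⁻ (edges s) m′
  ... | u∈W , _ | inj₁ m″ = s-out m″ u∈W
  ... | _ , v∈W | inj₂ m″ = t-out m″ v∈W

twinlessArcs⇒TwinlessConn : (r : Walk K x y) → (∀ {c d} → (c , d) ∈ edges r → TwinlessConn H c d) →
  TwinlessConn H x y
twinlessArcs⇒TwinlessConn [] _ = TwinlessConn-refl
twinlessArcs⇒TwinlessConn (e ∷ r) twinless =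
  TwinlessConn-trans (twinless (here refl)) (twinlessArcs⇒TwinlessConn r (twinless ∘ there))

_∈ᵉ?_ : (e : Fin n × Fin n) (es : List (Fin n × Fin n)) → Dec (e ∈ es)
_∈ᵉ?_ = DecMembership._∈?_ (Product.≡-dec _≟_ _≟_)

TwinlessConn? : (H : Graph n) (a b : Fin n) → Dec (TwinlessConn H a b)
TwinlessConn? {n = n} H a b =
  map′ (λ (p , _ , sp , q , _ , sq , p∦q) → p , q , sp , sq , λ c d m → All.lookup p∦q m)
       (λ (p , q , sp , sq , p∦q) → p , <⇒≤ (Simple⇒walkLength< p sp) , sp ,
                                    q , <⇒≤ (Simple⇒walkLength< q sq) , sq , All.tabulate λ m → p∦q _ _ m)
       (anyWalk? n _ λ p → simple? p ×-dec anyWalk? n _ λ q → simple? q ×-dec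
          All.all? (λ (c , d) → ¬? ((d , c) ∈ᵉ? edges q)) (edges p))
  where
  simple? : (p : Walk H u v) → Dec (Simple p)
  simple? p = unique? _≟_ (vertices p)

TSC? : (H : Graph n) → Dec (TSC H)
TSC? H = all? λ x → all? λ y → TwinlessConn? H x y

arc+returnWalk⇒TwinlessConn : H c d ≡ true → (q : Walk H d c) → (d , c) ∉ edges q → TwinlessConn H c d
arc+returnWalk⇒TwinlessConn {c = c} {d = d} cd q dc∉q with c ≟ d | loopErase q
... | yes refl | _ = TwinlessConn-refl
... | no c≢d | q′ , sq′ , q′⊆q =
  cd ∷ [] , q′ , Unique-∷ (λ { (here eq) → c≢d eq }) ([] ∷ []) , sq′ , λ { _ _ (here refl) m → dc∉q (q′⊆q m) }

StronglyConnected : Graph n → Set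
StronglyConnected {n} H = (x y : Fin n) → Walk H x y

TSC⇒StronglyConnected : TSC H → StronglyConnected H
TSC⇒StronglyConnected tsc x y = proj₁ (tsc x y)

nonTwinlessArc⇒twin : StronglyConnected H → H c d ≡ true → ¬ TwinlessConn H c d → H d c ≡ true
nonTwinlessArc⇒twin {H = H} {c = c} {d = d} sc cd c≁d with H d c in dc
... | true = refl
... | false = ⊥-elim (c≁d (arc+returnWalk⇒TwinlessConn cd (sc d c)
                λ m → true≢false (trans (sym (edge⇒arc (sc d c) m)) dc)))

nonTwinlessArc : (p : Walk K x y) → ¬ TwinlessConn H x y →
  ∃[ c ] ∃[ d ] (c , d) ∈ edges p × ¬ TwinlessConn H c d
nonTwinlessArc [] x≁x = ⊥-elim (x≁x TwinlessConn-refl)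
nonTwinlessArc {x = x} {H = H} (_∷_ {b = x′} e p) x≁y with TwinlessConn? H x x′
... | no x≁x′ = x , x′ , here refl , x≁x′
... | yes x∼x′ with nonTwinlessArc p (λ x′∼y → x≁y (TwinlessConn-trans x∼x′ x′∼y))
...   | c , d , m , c≁d = c , d , there m , c≁d

-- Counting arcs

𝟙 : Bool → ℕ
𝟙 b = if b then 1 else 0

δ : Fin n → Fin n → ℕ
δ i j = 𝟙 (does (i ≟ j))

δ-refl : (i : Fin n) → δ i i ≡ 1
δ-refl i = cong 𝟙 (dec-true (i ≟ i) refl)

𝟙-does-mono : {P Q : Set} → (P → Q) → (P? : Dec P) (Q? : Dec Q) → 𝟙 (does P?) ≤ 𝟙 (does Q?)
𝟙-does-mono P⇒Q (yes p) Q? rewrite dec-true Q? (P⇒Q p) = ≤-refl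
𝟙-does-mono P⇒Q (no _) Q? = z≤n

𝟙-does-< : {P Q : Set} → ¬ P → Q → (P? : Dec P) (Q? : Dec Q) → 𝟙 (does P?) < 𝟙 (does Q?)
𝟙-does-< ¬p q P? Q? rewrite dec-false P? ¬p | dec-true Q? q = s≤s z≤n

∑-mono-≤ : {f g : Fin n → ℕ} → (∀ i → f i ≤ g i) → ∑[ i < n ] f i ≤ ∑[ i < n ] g i
∑-mono-≤ {zero} f≤g = z≤n
∑-mono-≤ {suc n} f≤g = +-mono-≤ (f≤g Fin.zero) (∑-mono-≤ (f≤g ∘ Fin.suc))

∑-mono-< : {f g : Fin n → ℕ} → (∀ i → f i ≤ g i) → (k : Fin n) → f k < g k → ∑[ i < n ] f i < ∑[ i < n ] g i
∑-mono-< f≤g Fin.zero fk<gk = +-mono-<-≤ fk<gk (∑-mono-≤ (f≤g ∘ Fin.suc))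
∑-mono-< f≤g (Fin.suc k) fk<gk = +-mono-≤-< (f≤g Fin.zero) (∑-mono-< (f≤g ∘ Fin.suc) k fk<gk)

≤-∑ : (f : Fin n → ℕ) (i : Fin n) → f i ≤ ∑[ j < n ] f j
≤-∑ f Fin.zero = m≤m+n (f Fin.zero) _
≤-∑ f (Fin.suc i) = ≤-trans (≤-∑ (f ∘ Fin.suc) i) (m≤n+m _ (f Fin.zero))

∑-const : (n k : ℕ) → ∑[ i < n ] k ≡ n * k
∑-const zero k = refl
∑-const (suc n) k = cong (k +_) (∑-const n k)

∑-δ : (i : Fin n) → ∑[ j < n ] δ i j ≡ 1
∑-δ {suc n} Fin.zero = cong suc (trans (∑-const n 0) (*-zeroʳ n))
∑-δ {suc n} (Fin.suc i) = ∑-δ i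

listSum-allFin : (f : Fin n → ℕ) → List.sum (map f (allFin n)) ≡ ∑[ i < n ] f i
listSum-allFin {n} f = trans (cong List.sum (map-tabulate (λ i → i) f)) (sum-tabulate f)
  where
  sum-tabulate : ∀ {m} (g : Fin m → ℕ) → List.sum (tabulate g) ≡ ∑[ i < m ] g i
  sum-tabulate {zero} g = refl
  sum-tabulate {suc m} g = cong (g Fin.zero +_) (sum-tabulate (g ∘ Fin.suc))

∑∑ : (Fin n → Fin n → ℕ) → ℕ
∑∑ {n} f = ∑[ x < n ] ∑[ y < n ] f x y

∑∑-mono-≤ : {f g : Fin n → Fin n → ℕ} → (∀ x y → f x y ≤ g x y) → ∑∑ f ≤ ∑∑ g
∑∑-mono-≤ f≤g = ∑-mono-≤ λ x → ∑-mono-≤ (f≤g x)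

∑∑-mono-< : {f g : Fin n → Fin n → ℕ} → (∀ x y → f x y ≤ g x y) → (p q : Fin n) → f p q < g p q → ∑∑ f < ∑∑ g
∑∑-mono-< f≤g p q fpq<gpq = ∑-mono-< (λ x → ∑-mono-≤ (f≤g x)) p (∑-mono-< (f≤g p) q fpq<gpq)

∑∑-distrib-+ : (f g : Fin n → Fin n → ℕ) → ∑∑ (λ x y → f x y + g x y) ≡ ∑∑ f + ∑∑ g
∑∑-distrib-+ {n} f g = trans (sum-cong-≗ {n} λ x → ∑-distrib-+ (f x) (g x))
                              (∑-distrib-+ (λ x → ∑[ y < n ] f x y) (λ x → ∑[ y < n ] g x y))

∑∑-const-1 : ∑∑ {n} (λ _ _ → 1) ≡ n * n
∑∑-const-1 {n} = trans (sum-cong-≗ {n} λ _ → trans (∑-const n 1) (*-identityʳ n)) (∑-const n n)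

∑∑-δδ : (p q : Fin n) → ∑∑ (λ x y → δ p x * δ q y) ≡ 1
∑∑-δδ {n} p q = trans (sum-cong-≗ {n} row) (∑-δ p)
  where
  row : ∀ x → ∑[ y < n ] (δ p x * δ q y) ≡ δ p x
  row x = begin
    ∑[ y < n ] (δ p x * δ q y) ≡⟨ *-distribˡ-sum (δ p x) (δ q) ⟨
    δ p x * ∑[ y < n ] δ q y   ≡⟨ cong (δ p x *_) (∑-δ q) ⟩
    δ p x * 1                  ≡⟨ *-identityʳ (δ p x) ⟩
    δ p x                      ∎
    where open ≡-Reasoning

size≡∑∑ : (A : Graph n) → size A ≡ ∑∑ (λ x y → 𝟙 (A x y))
size≡∑∑ {n} A =
  trans (listSum-allFin (λ x → List.sum (map (λ y → 𝟙 (A x y)) (allFin n))))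
        (sum-cong-≗ {n} λ x → listSum-allFin (λ y → 𝟙 (A x y)))

size-exchange : {A B : Graph n} {p q p′ q′ : Fin n} →
  (∀ x y → A x y ≡ true → B x y ≡ true ⊎ (x ≡ p′ × y ≡ q′)) → A p q ≡ false → B p q ≡ true → size A ≤ size B
size-exchange {A = A} {B} {p} {q} {p′} {q′} A⊆B+p′q′ Apq Bpq = +-cancelʳ-≤ 1 (size A) (size B) (begin
  size A + 1                          ≡⟨ cong₂ _+_ (size≡∑∑ A) (sym (∑∑-δδ p q)) ⟩
  ∑∑ [A] + ∑∑ [pq]                    ≡⟨ ∑∑-distrib-+ [A] [pq] ⟨
  ∑∑ (λ x y → [A] x y + [pq] x y)     ≤⟨ ∑∑-mono-≤ pointwise ⟩
  ∑∑ (λ x y → [B] x y + [p′q′] x y)   ≡⟨ ∑∑-distrib-+ [B] [p′q′] ⟩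
  ∑∑ [B] + ∑∑ [p′q′]                  ≡⟨ cong₂ _+_ (sym (size≡∑∑ B)) (∑∑-δδ p′ q′) ⟩
  size B + 1                          ∎)
  where
  open ≤-Reasoning
  [A] [B] [pq] [p′q′] : Fin _ → Fin _ → ℕ
  [A] x y = 𝟙 (A x y)
  [B] x y = 𝟙 (B x y)
  [pq] x y = δ p x * δ q y
  [p′q′] x y = δ p′ x * δ q′ y
  arc-bound : ∀ x y → [A] x y ≤ [B] x y + [p′q′] x y
  arc-bound x y with A x y in Axy
  ... | false = z≤n
  ... | true with A⊆B+p′q′ x y Axy
  ...   | inj₁ Bxy rewrite Bxy = s≤s z≤n
  ...   | inj₂ (refl , refl) rewrite δ-refl p′ | δ-refl q′ = m≤n+m 1 _
  pointwise : ∀ x y → [A] x y + [pq] x y ≤ [B] x y + [p′q′] x y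
  pointwise x y with p ≟ x | q ≟ y
  ... | yes refl | yes refl rewrite Apq | Bpq = s≤s z≤n
  ... | no _ | _ = ≤-trans (≤-reflexive (+-identityʳ _)) (arc-bound x y)
  ... | yes _ | no _ = ≤-trans (≤-reflexive (+-identityʳ _)) (arc-bound x y)

size-∪ : (A B : Graph n) → size (A ∪ B) ≤ size A + size B
size-∪ A B = begin
  size (A ∪ B)                                  ≡⟨ size≡∑∑ (A ∪ B) ⟩
  ∑∑ (λ x y → 𝟙 (A x y ∨ B x y))                ≤⟨ ∑∑-mono-≤ (λ x y → 𝟙-∨ (A x y) (B x y)) ⟩
  ∑∑ (λ x y → 𝟙 (A x y) + 𝟙 (B x y))            ≡⟨ ∑∑-distrib-+ (λ x y → 𝟙 (A x y)) (λ x y → 𝟙 (B x y)) ⟩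
  ∑∑ (λ x y → 𝟙 (A x y)) + ∑∑ (λ x y → 𝟙 (B x y)) ≡⟨ cong₂ _+_ (size≡∑∑ A) (size≡∑∑ B) ⟨
  size A + size B                               ∎
  where
  open ≤-Reasoning
  𝟙-∨ : ∀ a b → 𝟙 (a ∨ b) ≤ 𝟙 a + 𝟙 b
  𝟙-∨ true _ = s≤s z≤n
  𝟙-∨ false _ = ≤-refl

indegree : Graph n → Fin n → ℕ
indegree {n} A v = ∑[ u < n ] 𝟙 (A u v)

size≡∑indegree : (A : Graph n) → size A ≡ ∑[ v < n ] indegree A v
size≡∑indegree {n} A = trans (size≡∑∑ A) (∑-comm {n} {n} λ x y → 𝟙 (A x y))

size-rev : (A : Graph n) → size (rev A) ≡ size A
size-rev A = trans (size≡∑∑ (rev A)) (sym (size≡∑indegree A))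

∑indegree+1 : (A : Graph n) (r : Fin n) → ∑[ v < n ] (indegree A v + δ r v) ≡ size A + 1
∑indegree+1 A r = trans (∑-distrib-+ (indegree A) (δ r)) (cong₂ _+_ (sym (size≡∑indegree A)) (∑-δ r))

SpanningOutTree⇒indegree : {G T : Graph n} {r : Fin n} → SpanningOutTree G r T → ∀ v → indegree T v + δ r v ≡ 1
SpanningOutTree⇒indegree {n} {T = T} {r} (_ , no-arc-into-r , unique-parent , _) v with r ≟ v
... | yes refl =
  cong (_+ 1) (trans (sum-cong-≗ {n} λ u → cong 𝟙 (no-arc-into-r u)) (trans (∑-const n 0) (*-zeroʳ n)))
... | no r≢v with unique-parent v (r≢v ∘ sym)
...   | u , uv , parent-unique = trans (+-identityʳ _) (trans (sum-cong-≗ {n} arc-from-u) (∑-δ u))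
  where
  arc-from-u : ∀ w → 𝟙 (T w v) ≡ δ u w
  arc-from-u w with u ≟ w
  ... | yes refl = cong 𝟙 uv
  ... | no u≢w = cong 𝟙 not-parent
    where
    not-parent : T w v ≡ false
    not-parent with T w v in wv
    ... | true = ⊥-elim (u≢w (sym (parent-unique w wv)))
    ... | false = refl

SpanningOutTree⇒size : {G T : Graph n} {r : Fin n} → SpanningOutTree G r T → size T + 1 ≡ n
SpanningOutTree⇒size {n} {T = T} {r} tree = begin
  size T + 1                          ≡⟨ ∑indegree+1 T r ⟨
  ∑[ v < n ] (indegree T v + δ r v)   ≡⟨ sum-cong-≗ {n} (SpanningOutTree⇒indegree tree) ⟩
  ∑[ v < n ] 1                        ≡⟨ ∑-const n 1 ⟩
  n * 1                               ≡⟨ *-identityʳ n ⟩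
  n                                   ∎
  where open ≡-Reasoning

StronglyConnected⇒size : {H : Graph n} → StronglyConnected H → (r : Fin n) → n ≤ size H + 1
StronglyConnected⇒size {n = n} {H = H} sc r = begin
  n                                   ≡⟨ *-identityʳ n ⟨
  n * 1                               ≡⟨ ∑-const n 1 ⟨
  ∑[ v < n ] 1                        ≤⟨ ∑-mono-≤ has-parent ⟩
  ∑[ v < n ] (indegree H v + δ r v)   ≡⟨ ∑indegree+1 H r ⟩
  size H + 1                          ∎
  where
  open ≤-Reasoning
  has-parent : ∀ v → 1 ≤ indegree H v + δ r v
  has-parent v with r ≟ v
  ... | yes refl = m≤n+m 1 _
  ... | no r≢v with lastArc (sc r v) r≢v
  ...   | u , uv = ≤-trans (≤-trans (≤-reflexive (cong 𝟙 (sym uv))) (≤-∑ (λ w → 𝟙 (H w v)) u)) (m≤m+n _ _)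

connectedPairs : Graph n → ℕ
connectedPairs H = ∑∑ λ x y → 𝟙 (does (TwinlessConn? H x y))

connectedPairs≤ : (H : Graph n) → connectedPairs H ≤ n * n
connectedPairs≤ {n} H =
  ≤-trans (∑∑-mono-≤ λ x y → 𝟙≤1 (does (TwinlessConn? H x y))) (≤-reflexive (∑∑-const-1 {n}))
  where
  𝟙≤1 : ∀ b → 𝟙 b ≤ 1
  𝟙≤1 true = ≤-refl
  𝟙≤1 false = z≤n

-- One iteration of the loop

Removed : {Et : Graph n} → Walk Et b a → Fin n → Fin n → Set
Removed {Et = Et} p x y = (y , x) ∈ edges p × ¬ TwinlessConn Et y x

UpdatedBy : (Et : Graph n) (a b : Fin n) → Walk Et b a → Graph n → Set
UpdatedBy {n} Et a b p Et′ = (x y : Fin n) →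
  (Et′ x y ≡ true → (Et x y ≡ true ⊎ (x ≡ a × y ≡ b)) × ¬ Removed p x y) ×
  ((Et x y ≡ true ⊎ (x ≡ a × y ≡ b)) → ¬ Removed p x y → Et′ x y ≡ true)

module Update {Et Et′ : Graph n} (sc : StronglyConnected Et) {a b : Fin n}
              (ab∉Et : Et a b ≡ false) (a≁b : ¬ TwinlessConn Et a b)
              (p : Walk Et b a) (p-simple : Simple p) (spec : UpdatedBy Et a b p Et′) where

  kept : Et x y ≡ true → ¬ Removed p x y → Et′ x y ≡ true
  kept e ¬removed = proj₂ (spec _ _) (inj₁ e) ¬removed

  kept-twinless : Et x y ≡ true → TwinlessConn Et x y → Et′ x y ≡ true
  kept-twinless e x∼y = kept e λ (_ , y≁x) → y≁x (TwinlessConn-sym x∼y)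

  kept-path : (x , y) ∈ edges p → Et′ x y ≡ true
  kept-path m = kept (edge⇒arc p m) λ (m′ , _) → Simple⇒TwinFree p p-simple m m′

  along-path : (q : Walk Et x y) → edges q ⊆ₗ edges p → Walk Et′ x y
  along-path q q⊆p = mapWalk q (All.tabulate λ { {_ , _} m → kept-path (q⊆p m) })

  ba∉p : (b , a) ∉ edges p
  ba∉p m = a≁b (TwinlessConn-sym (arc+returnWalk⇒TwinlessConn (edge⇒arc p m) (sc a b)
             λ m′ → true≢false (trans (sym (edge⇒arc (sc a b) m′)) ab∉Et)))

  added : Et′ a b ≡ true
  added = proj₂ (spec a b) (inj₂ (refl , refl)) λ (m , _) → ba∉p m

  connects : TwinlessConn Et′ a b
  connects = arc+returnWalk⇒TwinlessConn added (along-path p (λ m → m))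
    (ba∉p ∘ subst ((b , a) ∈_) (edges-mapWalk p _))

  preserves-twinless : TwinlessConn Et x y → TwinlessConn Et′ x y
  preserves-twinless {y = y} x∼y with TwinlessConn⇒TwinFreeClosedWalk x∼y
  ... | W , y∈W , tf = TwinFreeClosedWalk⇒TwinlessConn
    (mapWalk W kept′ , subst (y ∈_) (sym (vertices-mapWalk W kept′)) y∈W ,
     TwinFree-⊆ (⊆-reflexive (edges-mapWalk W kept′)) tf)
    where
    kept′ : All (λ (c , d) → Et′ c d ≡ true) (edges W)
    kept′ = All.tabulate λ { {_ , _} m →
      kept-twinless (edge⇒arc W m) (TwinFreeClosedWalk-arc⇒TwinlessConn W tf m) }

  -- A removed arc u → v is the twin of the path arc v → u, and is bypassed by following p from u to a,
  -- the new arc a → b, and p from b to v.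
  bypass : Et u v ≡ true → Walk Et′ u v
  bypass {u = u} {v = v} e with (v , u) ∈ᵉ? edges p
  ... | no vu∉p = kept e (vu∉p ∘ proj₁) ∷ []
  ... | yes vu∈p with suffixFrom p (proj₂ (edge⇒vertices p vu∈p)) | prefixTo p (proj₁ (edge⇒vertices p vu∈p))
  ...   | to-a , to-a⊆p | from-b , from-b⊆p = along-path to-a to-a⊆p ++ʷ (added ∷ along-path from-b from-b⊆p)

  stronglyConnected : StronglyConnected Et′
  stronglyConnected x y =
    proj₁ (replaceArcs {Q = λ _ → ⊤} (sc x y) λ m → bypass (edge⇒arc (sc x y) m) , All.tabulate _)

  shrinks : size Et′ ≤ size Et
  shrinks with nonTwinlessArc p (a≁b ∘ TwinlessConn-sym)
  ... | i , j , ij∈p , i≁j =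
    size-exchange (λ x y e → proj₁ (proj₁ (spec x y) e)) ji∉Et′ (nonTwinlessArc⇒twin sc (edge⇒arc p ij∈p) i≁j)
    where
    ji∉Et′ : Et′ j i ≡ false
    ji∉Et′ with Et′ j i in ji
    ... | true = ⊥-elim (proj₂ (proj₁ (spec j i) ji) (ij∈p , i≁j))
    ... | false = refl

  gains : connectedPairs Et < connectedPairs Et′
  gains = ∑∑-mono-< (λ x y → 𝟙-does-mono preserves-twinless (TwinlessConn? Et x y) (TwinlessConn? Et′ x y))
                     a b (𝟙-does-< a≁b connects (TwinlessConn? Et a b) (TwinlessConn? Et′ a b))

removed? : {Et : Graph n} (p : Walk Et b a) (x y : Fin n) → Dec (Removed p x y)
removed? {Et = Et} p x y = ((y , x) ∈ᵉ? edges p) ×-dec ¬? (TwinlessConn? Et y x)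

update : (Et : Graph n) (a b : Fin n) → Walk Et b a → Graph n
update Et a b p x y = does (((Et x y Bool.≟ true) ⊎-dec ((x ≟ a) ×-dec (y ≟ b))) ×-dec ¬? (removed? p x y))

update-UpdatedBy : (Et : Graph n) (a b : Fin n) (p : Walk Et b a) → UpdatedBy Et a b p (update Et a b p)
update-UpdatedBy Et a b p x y = dec-true⁻¹ decision , λ kept ¬removed → dec-true decision (kept , ¬removed)
  where decision = ((Et x y Bool.≟ true) ⊎-dec ((x ≟ a) ×-dec (y ≟ b))) ×-dec ¬? (removed? p x y)

module _ {G Et : Graph n} (outside-twinless : ∀ u v → G u v ≡ true → Et u v ≡ false → TwinlessConn Et u v) where

  -- Each arc of G is either an arc of Et or spanned by a twin-free closed walk of Et.
  liftWalk : (r : Walk G x y) →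
    Σ (Walk Et x y) λ r′ → All (λ (u , v) → (u , v) ∈ edges r ⊎ TwinlessConn Et u v) (edges r′)
  liftWalk r = replaceArcs r lift-arc
    where
    lift-arc : (u , v) ∈ edges r →
      Σ (Walk Et u v) λ s → All (λ (c , d) → (c , d) ∈ edges r ⊎ TwinlessConn Et c d) (edges s)
    lift-arc {u} {v} m with Et u v in uv
    ... | true = uv ∷ [] , inj₁ m ∷ []
    ... | false with TwinlessConn⇒TwinFreeClosedWalk (outside-twinless u v (edge⇒arc r m) uv)
    ...   | W , v∈W , tf with prefixTo W v∈W
    ...     | s , s⊆W =
      s , All.tabulate λ { {_ , _} m′ → inj₂ (TwinFreeClosedWalk-arc⇒TwinlessConn W tf (s⊆W m′)) }

  -- For an arc c → d of Et, the rest of W is a walk of G from d back to c avoiding the twin d → c;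
  -- lifted to Et it still avoids d → c, unless one of its arcs already shows that d and c are connected.
  closedWalkArc-twinless : (W : Walk G u u) → TwinFree (edges W) → (c , d) ∈ edges W → TwinlessConn Et c d
  closedWalkArc-twinless {c = c} {d = d} W tf cd∈W with Et c d in cd
  ... | false = outside-twinless c d (edge⇒arc W cd∈W) cd
  ... | true with rotate W (proj₂ (edge⇒vertices W cd∈W))
  ...   | W′ , W′⊆W , W⊆W′ with prefixTo W′ (proj₁ (edge⇒vertices W′ (W⊆W′ cd∈W)))
  ...     | r , r⊆W′ with liftWalk r
  ...       | r′ , origin with (d , c) ∈ᵉ? edges r′
  ...         | no dc∉r′ = arc+returnWalk⇒TwinlessConn cd r′ dc∉r′
  ...         | yes dc∈r′ with All.lookup origin dc∈r′
  ...           | inj₁ dc∈r = ⊥-elim (tf cd∈W (W′⊆W (r⊆W′ dc∈r)))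
  ...           | inj₂ d∼c = TwinlessConn-sym d∼c

  all-twinless : TSC G → TSC Et
  all-twinless tscG x y with TwinlessConn⇒TwinFreeClosedWalk (tscG x y)
  ... | W , y∈W , tf with prefixTo W y∈W
  ...   | r , r⊆W = twinlessArcs⇒TwinlessConn r λ m → closedWalkArc-twinless W tf (r⊆W m)

step-exists : {G Et : Graph n} → TSC G → StronglyConnected Et → ¬ TSC Et → ∃[ Et′ ] Step G Et Et′
step-exists {G = G} {Et} tscG sc ¬tsc
  with any? (λ a → any? λ b → (G a b Bool.≟ true) ×-dec (Et a b Bool.≟ false) ×-dec ¬? (TwinlessConn? Et a b))
... | yes (a , b , ab∈G , ab∉Et , a≁b) with loopErase (sc b a)
...   | p , p-simple , _ =
  update Et a b p , a , b , ab∈G , ab∉Et , a≁b , p , p-simple , update-UpdatedBy Et a b p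
step-exists {G = G} {Et} tscG sc ¬tsc | no no-candidate = ⊥-elim (¬tsc (all-twinless outside-twinless tscG))
  where
  outside-twinless : ∀ u v → G u v ≡ true → Et u v ≡ false → TwinlessConn Et u v
  outside-twinless u v uv∈G uv∉Et with TwinlessConn? Et u v
  ... | yes u∼v = u∼v
  ... | no u≁v = ⊥-elim (no-candidate (u , v , uv∈G , uv∉Et , u≁v))

-- The loop

-- The size bound is |E_t| ≤ 2(n − 1), stated without truncated subtraction.
Invariant : Graph n → Graph n → Set
Invariant {n} G Et = Et ⊆ G × StronglyConnected Et × size Et + 2 ≤ 2 * n

initial-Invariant : {G T Tr : Graph n} {r : Fin n} →
  SpanningOutTree G r T → SpanningOutTree (rev G) r Tr → Invariant G (T ∪ rev Tr)
initial-Invariant {n} {G} {T} {Tr} {r} tree@(T⊆G , _ , _ , reach) tree-rev@(Tr⊆revG , _ , _ , reach-rev) =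
  ⊆G , (λ x y → via-r x ++ʷ from-r y) , bound
  where
  via-r : ∀ x → Walk (T ∪ rev Tr) x r
  via-r x = Walk-⊆ (∪-⊆ʳ T (rev Tr)) (reverseWalk (reach-rev x))
  from-r : ∀ y → Walk (T ∪ rev Tr) r y
  from-r y = Walk-⊆ (∪-⊆ˡ T (rev Tr)) (reach y)
  ⊆G : (T ∪ rev Tr) ⊆ G
  ⊆G x y e with T x y in xy
  ... | true = T⊆G x y xy
  ... | false = Tr⊆revG y x e
  bound : size (T ∪ rev Tr) + 2 ≤ 2 * n
  bound = begin
    size (T ∪ rev Tr) + 2           ≤⟨ +-mono-≤ (size-∪ T (rev Tr)) ≤-refl ⟩
    size T + size (rev Tr) + 2      ≡⟨ cong (λ s → size T + s + 2) (size-rev Tr) ⟩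
    size T + size Tr + 2            ≡⟨ regroup-+2 (size T) (size Tr) ⟩
    (size T + 1) + (size Tr + 1)    ≡⟨ cong₂ _+_ (SpanningOutTree⇒size tree) (SpanningOutTree⇒size tree-rev) ⟩
    n + n                           ≡⟨ cong (n +_) (+-identityʳ n) ⟨
    2 * n                           ∎
    where
    open ≤-Reasoning
    regroup-+2 : ∀ s t → s + t + 2 ≡ (s + 1) + (t + 1)
    regroup-+2 = solve-∀

module _ {G : Graph n} where

  step-Invariant : {Et Et′ : Graph n} → Invariant G Et → Step G Et Et′ → Invariant G Et′
  step-Invariant (Et⊆G , sc , bound) (a , b , ab∈G , ab∉Et , a≁b , p , p-simple , spec) =
    Et′⊆G , stronglyConnected , ≤-trans (+-mono-≤ shrinks ≤-refl) bound
    where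
    open Update sc ab∉Et a≁b p p-simple spec
    Et′⊆G : _ ⊆ G
    Et′⊆G x y e with proj₁ (proj₁ (spec x y) e)
    ... | inj₁ xy∈Et = Et⊆G x y xy∈Et
    ... | inj₂ (refl , refl) = ab∈G

  step-gains : {Et Et′ : Graph n} → Invariant G Et → Step G Et Et′ → connectedPairs Et < connectedPairs Et′
  step-gains (_ , sc , _) (a , b , _ , ab∉Et , a≁b , p , p-simple , spec) = gains
    where open Update sc ab∉Et a≁b p p-simple spec

  module _ (tscG : TSC G) where
    mutual
      terminates : {Et : Graph n} (k : ℕ) → Invariant G Et → n * n ≤ connectedPairs Et + k → Terminates G Et
      terminates {Et} k inv bound with TSC? Et
      ... | yes tsc = halt tsc
      ... | no ¬tsc =
        continue ¬tsc (step-exists tscG (proj₁ (proj₂ inv)) ¬tsc) λ _ st → terminates-after k inv bound st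

      terminates-after : {Et Et′ : Graph n} (k : ℕ) → Invariant G Et → n * n ≤ connectedPairs Et + k →
                         Step G Et Et′ → Terminates G Et′
      terminates-after {Et′ = Et′} zero inv bound st =
        ⊥-elim (<⇒≱ (≤-<-trans (≤-trans bound (≤-reflexive (+-identityʳ _))) (step-gains inv st))
                    (connectedPairs≤ Et′))
      terminates-after {Et} (suc k) inv bound st =
        terminates k (step-Invariant inv st)
          (≤-trans bound (≤-trans (≤-reflexive (+-suc (connectedPairs Et) k)) (+-monoˡ-≤ k (step-gains inv st))))

  run-Invariant : {Et Eout : Graph n} → Invariant G Et → Run G Et Eout → TSC Eout × Invariant G Eout
  run-Invariant inv (done tsc) = tsc , inv
  run-Invariant inv (step _ st run) = run-Invariant (step-Invariant inv st) run

twice-bound : (s t n : ℕ) → s + 2 ≤ 2 * n → n ≤ t + 1 → s ≤ 2 * t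
twice-bound s t n s+2≤2n n≤t+1 =
  +-cancelʳ-≤ 2 s (2 * t) (≤-trans s+2≤2n (≤-trans (*-monoʳ-≤ 2 n≤t+1) (≤-reflexive (*-distribˡ-+ 2 t 1))))

mainTheorem7 : (n : ℕ) (G : Graph n) → Loopless G → TSC G →
    (r : Fin n) (T Tr : Graph n) →
    SpanningOutTree G r T → SpanningOutTree (rev G) r Tr →
    Terminates G (T ∪ rev Tr) ×
    ((Eout : Graph n) → Run G (T ∪ rev Tr) Eout →
      TSC Eout × (Eout ⊆ G) ×
      ((E* : Graph n) → Optimal G E* → size Eout ≤ 2 * size E*))
mainTheorem7 n G _ tscG r T Tr tree tree-rev =
  terminates tscG (n * n) inv₀ (m≤n+m _ _) ,
  λ Eout run → let (tsc , Eout⊆G , _ , bound) = run-Invariant inv₀ run in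
    tsc , Eout⊆G , λ E* (_ , tsc* , _) →
      twice-bound (size Eout) (size E*) n bound (StronglyConnected⇒size (TSC⇒StronglyConnected tsc*) r)
  where
  inv₀ : Invariant G (T ∪ rev Tr)
  inv₀ = initial-Invariant tree tree-rev
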